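{- Let $n$ be a positive integer. Let $m(n)$ be the number of moves in the deterministic play of the Zeckendorf Game on $n$ in which the players must always move on the largest valued number (i.e., each move acts on the largest summand for which a legal move is available), and let $Z(n)$ be the number of terms in the Zeckendorf decomposition of $n$. Then $m(n)=n-Z(n)$.
   Context: Fibonacci numbers are indexed as $F_1=1$, $F_2=2$, $F_{i+1}=F_i+F_{i-1}$. The Zeckendorf decomposition of $n$ is its unique representation as a sum of distinct, pairwise non-adjacent Fibonacci numbers in this indexing. The Zeckendorf Game on $n$: the state is an unordered multiset of Fibonacci numbers summing to $n$, initially $n$ copies of $F_1$; a legal move is one of: (1) replace $F_{i-1},F_i$ by $F_{i+1}$; (2a) replace $F_1,F_1$ by $F_2$; (2b) replace $F_2,F_2$ by $F_1,F_3$; (2c) for $i\ge3$, replace $F_i,F_i$ by $F_{i-2},F_{i+1}$. The game ends when no legal move remains, which happens exactly at the Zeckendorf decomposition. -}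

module Defs where

open import Data.Nat using (ℕ; zero; suc; _+_; _∸_; _≤_; _≡ᵇ_)
open import Data.Bool using (if_then_else_)
open import Data.List using (List; []; _∷_; map)
open import Data.Nat.ListAction using (sum)
open import Data.Unit using (⊤)
open import Relation.Binary.PropositionalEquality using (_≡_)
open import Data.List.Relation.Unary.All using (All)
open import Data.Product using (Σ; _×_)
open import Relation.Nullary using (¬_)

-- Fibonacci numbers with the paper's indexing: F 1 = 1, F 2 = 2,
-- F (i+1) = F i + F (i-1).  (F 0 is unused; set to 0.)
F : ℕ → ℕ
F zero = 0
F (suc zero) = 1
F (suc (suc zero)) = 2
F (suc (suc (suc i))) = F (suc (suc i)) + F (suc i)

-- Zeckendorf decomposition, written as the list of its Fibonacci indices
-- in strictly decreasing order with consecutive indices differing by at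
-- least 2 (i.e. distinct and pairwise non-adjacent), all indices ≥ 1.
data NonAdjDecreasing : List ℕ → Set where
  []  : NonAdjDecreasing []
  [_] : (i : ℕ) → NonAdjDecreasing (i ∷ [])
  _∷_ : ∀ {i j is} → j + 2 ≤ i → NonAdjDecreasing (j ∷ is) →
        NonAdjDecreasing (i ∷ j ∷ is)

IsZeckendorf : ℕ → List ℕ → Set
IsZeckendorf n zs =
  All (λ i → 1 ≤ i) zs × NonAdjDecreasing zs × sum (map F zs) ≡ n

-- A game state: a multiset of Fibonacci numbers, given by multiplicities:
-- c i = number of copies of F i in the multiset (c 0 is unused).
State : Set
State = ℕ → ℕ

start : ℕ → State
start n (suc zero) = n
start n _          = 0

count : List ℕ → ℕ → ℕ
count l j = sum (map (λ i → if i ≡ᵇ j then 1 else 0) l)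

data Move : Set where
  add    : ℕ → Move  -- add k   : F k , F (k+1) ↦ F (k+2)   (rule 1, i = k+1; needs k ≥ 1)
  add11  : Move      -- rule 2a : F 1 , F 1     ↦ F 2
  split2 : Move      -- rule 2b : F 2 , F 2     ↦ F 1 , F 3
  split  : ℕ → Move  -- split i : F i , F i     ↦ F (i-2) , F (i+1)  (rule 2c; needs i ≥ 3)

consumed : Move → List ℕ
consumed (add k)   = k ∷ suc k ∷ []
consumed add11     = 1 ∷ 1 ∷ []
consumed split2    = 2 ∷ 2 ∷ []
consumed (split i) = i ∷ i ∷ []

produced : Move → List ℕ
produced (add k)   = suc (suc k) ∷ []
produced add11     = 2 ∷ []
produced split2    = 1 ∷ 3 ∷ []
produced (split i) = i ∸ 2 ∷ suc i ∷ []

IndexOK : Move → Set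
IndexOK (add k)   = 1 ≤ k
IndexOK add11     = ⊤
IndexOK split2    = ⊤
IndexOK (split i) = 3 ≤ i

Legal : Move → State → Set
Legal m c = IndexOK m × (∀ j → count (consumed m) j ≤ c j)

apply : Move → State → State
apply m c j = (c j ∸ count (consumed m) j) + count (produced m) j

-- the largest summand a move acts on
top : Move → ℕ
top (add k)   = suc k
top add11     = 1
top split2    = 2
top (split i) = i

Terminal : State → Set
Terminal c = ∀ m → ¬ Legal m c

-- Plays c k : the play from state c in which every move acts on the largest
-- summand for which a legal move is available ends (at a terminal state)
-- after exactly k moves.
data Plays : State → ℕ → Set where
  done : ∀ {c} → Terminal c → Plays c 0
  step : ∀ {c k} (m : Move) → Legal m c →
         (∀ m' → Legal m' c → top m' ≤ top m) →
         Plays (apply m c) k → Plays c (suc k)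

module Submission where

-- A state is measured by two finite weighted sums over the indices j ≤ n:
-- its value Σ c j · F j and its size Σ c j (the number of summands).
-- Along a greedy play from the start we maintain the invariant "value n,
-- support in [1, n], every F j with j ≥ 2 present at most once".  Under it
-- no splitting move is legal, and a greedy move is a merge
-- F k , F (k+1) ↦ F (k+2) (or F 1 , F 1 ↦ F 2) whose target slot is empty,
-- since otherwise a merge on a larger summand would be legal.  So each
-- greedy move keeps the invariant and lowers the size by one.  A terminal
-- state under the invariant is a Zeckendorf decomposition, and by uniqueness
-- of Zeckendorf decompositions its size is Z(n); hence every greedy play has
-- n − Z(n) moves.  Conversely a greedy play exists: a bounded search finds a
-- greedy move in every non-terminal state, and the size strictly decreases.

open import Defs
open import Data.Nat using (ℕ; zero; suc; _+_; _*_; _∸_; _≤_; _<_; _≡ᵇ_; z≤n; s≤s; _≟_; _≤?_)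
open import Data.Nat.Properties
open import Algebra.Properties.CommutativeSemigroup +-commutativeSemigroup
  using (interchange; xy∙z≈xz∙y)
open import Data.Bool using (if_then_else_)
open import Data.List using (List; []; _∷_; map; length)
open import Data.Nat.ListAction using (sum)
open import Data.List.Relation.Unary.All as All using (All; []; _∷_)
open import Data.Product using (Σ; _×_; _,_; proj₁; proj₂)
open import Data.Sum using (_⊎_; inj₁; inj₂)
open import Data.Unit using (tt)
open import Data.Empty using (⊥-elim)
open import Function using (_∘_)
open import Relation.Nullary using (¬_; yes; no)
open import Relation.Nullary.Decidable using (_×-dec_)
open import Relation.Unary using (Decidable)
open import Relation.Binary.PropositionalEquality
open import Function.Bundles using (_⇔_; mk⇔)

-- δ i j = [i = j]; by definition count (i ∷ l) j unfolds to δ i j + count l j.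
δ : ℕ → ℕ → ℕ
δ i j = if i ≡ᵇ j then 1 else 0

δ-refl : ∀ i → δ i i ≡ 1
δ-refl zero    = refl
δ-refl (suc i) = δ-refl i

δ-neq : ∀ {i j} → i ≢ j → δ i j ≡ 0
δ-neq {zero}  {zero}  i≢j = ⊥-elim (i≢j refl)
δ-neq {zero}  {suc j} _   = refl
δ-neq {suc i} {zero}  _   = refl
δ-neq {suc i} {suc j} i≢j = δ-neq (i≢j ∘ cong suc)

count-absent : ∀ {j} l → All (_≢ j) l → count l j ≡ 0
count-absent []      []         = refl
count-absent (i ∷ l) (i≢j ∷ ps) rewrite δ-neq i≢j = count-absent l ps

count-present : ∀ {P : ℕ → Set} {j} l → All P l → 1 ≤ count l j → P j
count-present {j = j} (i ∷ l) (p ∷ ps) counted with i ≟ j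
... | yes refl = p
... | no i≢j rewrite δ-neq i≢j = count-present l ps counted

-- weight b w c = Σ_{j<b} c j · w j, the total w-weight of the summands of c
-- with index below b: w = F gives the value of c, w = 1 its number of summands.
weight : ℕ → (ℕ → ℕ) → State → ℕ
weight zero    w c = 0
weight (suc b) w c = weight b w c + c b * w b

weight-zero : ∀ b w → weight b w (λ _ → 0) ≡ 0
weight-zero zero    w = refl
weight-zero (suc b) w = trans (+-identityʳ _) (weight-zero b w)

weight-+ : ∀ b w f g → weight b w (λ j → f j + g j) ≡ weight b w f + weight b w g
weight-+ zero    w f g = refl
weight-+ (suc b) w f g = begin
    weight b w (λ j → f j + g j) + (f b + g b) * w b
  ≡⟨ cong₂ _+_ (weight-+ b w f g) (*-distribʳ-+ (w b) (f b) (g b)) ⟩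
    (weight b w f + weight b w g) + (f b * w b + g b * w b)
  ≡⟨ interchange (weight b w f) (weight b w g) (f b * w b) (g b * w b) ⟩
    (weight b w f + f b * w b) + (weight b w g + g b * w b) ∎
  where open ≡-Reasoning

weight-cong : ∀ b w {f g} → (∀ j → j < b → f j ≡ g j) → weight b w f ≡ weight b w g
weight-cong zero    w f≗g = refl
weight-cong (suc b) w f≗g =
  cong₂ _+_ (weight-cong b w (λ j j<b → f≗g j (m<n⇒m<1+n j<b))) (cong (_* w b) (f≗g b (n<1+n b)))

weight-mono : ∀ b w {f g} → (∀ j → f j ≤ g j) → weight b w f ≤ weight b w g
weight-mono zero    w f≤g = z≤n
weight-mono (suc b) w f≤g = +-mono-≤ (weight-mono b w f≤g) (*-monoˡ-≤ (w b) (f≤g b))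

weight-δ-above : ∀ b w {i} → b ≤ i → weight b w (δ i) ≡ 0
weight-δ-above zero    w b≤i = refl
weight-δ-above (suc b) w b<i
  rewrite weight-δ-above b w (<⇒≤ b<i) | δ-neq (>⇒≢ b<i) = refl

weight-δ : ∀ b w {i} → i < b → weight b w (δ i) ≡ w i
weight-δ (suc b) w {i} i<1+b with m≤n⇒m<n∨m≡n (≤-pred i<1+b)
... | inj₁ i<b  rewrite weight-δ b w i<b | δ-neq (<⇒≢ i<b) = +-identityʳ (w i)
... | inj₂ refl rewrite weight-δ-above b w (≤-refl {b}) | δ-refl b = +-identityʳ (w b)

weight-count : ∀ b w {l} → All (_< b) l → weight b w (count l) ≡ sum (map w l)
weight-count b w {[]}    []            = weight-zero b w
weight-count b w {i ∷ l} (i<b ∷ l<b) = begin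
    weight b w (count (i ∷ l))
  ≡⟨ weight-+ b w (δ i) (count l) ⟩
    weight b w (δ i) + weight b w (count l)
  ≡⟨ cong₂ _+_ (weight-δ b w i<b) (weight-count b w l<b) ⟩
    w i + sum (map w l) ∎
  where open ≡-Reasoning

-- transfer a p c: the state c with the summands listed in a removed and those
-- listed in p added; by definition apply m c = transfer (consumed m) (produced m) c.
transfer : List ℕ → List ℕ → State → State
transfer a p c j = (c j ∸ count a j) + count p j

weight-transfer : ∀ b w {a p c} → (∀ j → count a j ≤ c j) → All (_< b) a → All (_< b) p →
  weight b w (transfer a p c) + sum (map w a) ≡ weight b w c + sum (map w p)
weight-transfer b w {a} {p} {c} a⊆c a<b p<b = begin
    weight b w (transfer a p c) + sum (map w a)
  ≡⟨ cong₂ _+_ (weight-+ b w rest (count p)) (sym (weight-count b w a<b)) ⟩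
    (W rest + W (count p)) + W (count a)
  ≡⟨ xy∙z≈xz∙y (W rest) (W (count p)) (W (count a)) ⟩
    (W rest + W (count a)) + W (count p)
  ≡⟨ cong (_+ W (count p)) restored ⟩
    W c + W (count p)
  ≡⟨ cong (W c +_) (weight-count b w p<b) ⟩
    W c + sum (map w p) ∎
  where
  open ≡-Reasoning
  W : State → ℕ
  W = weight b w
  rest : State
  rest j = c j ∸ count a j
  restored : W rest + W (count a) ≡ W c
  restored = trans (sym (weight-+ b w rest (count a))) (weight-cong b w (λ j _ → m∸n+n≡m (a⊆c j)))

F-positive : ∀ i → 1 ≤ F (suc i)
F-positive zero          = s≤s z≤n
F-positive (suc zero)    = s≤s z≤n
F-positive (suc (suc i)) = ≤-trans (F-positive (suc i)) (m≤m+n _ _)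

-- Fibonacci numbers dominate their indices; this bounds the indices of a
-- decomposition of n by n.
index-≤-F : ∀ j → j ≤ F j
index-≤-F zero                = z≤n
index-≤-F (suc zero)          = s≤s z≤n
index-≤-F (suc (suc zero))    = s≤s (s≤s z≤n)
index-≤-F (suc (suc (suc i))) =
  subst (_≤ F (suc (suc (suc i)))) (+-comm (suc (suc i)) 1) (+-mono-≤ (index-≤-F (suc (suc i))) (F-positive i))

F-merge : ∀ k → 1 ≤ k → F k + F (suc k) ≡ F (suc (suc k))
F-merge (suc k) _ = +-comm (F (suc k)) (F (suc (suc k)))

record IsZeckendorfState (c : State) : Set where
  field
    no-F0        : c 0 ≡ 0
    at-most-once : ∀ j → c j ≤ 1
    non-adjacent : ∀ j → c j ≡ 1 → c (suc j) ≡ 0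

open IsZeckendorfState

zero-or-one : ∀ {x} → x ≤ 1 → x ≡ 0 ⊎ x ≡ 1
zero-or-one z≤n       = inj₁ refl
zero-or-one (s≤s z≤n) = inj₂ refl

-- Inductive step of the Zeckendorf estimate below: if the bound holds up to
-- F (t+1) and F (t+2), it holds for F (t+3), distinguishing whether F (t+2)
-- is present (then F (t+1) is absent).
zeckendorf-bound-step : ∀ {c} → IsZeckendorfState c → ∀ t →
  weight (suc (suc t)) F c < F (suc (suc t)) → weight (suc t) F c < F (suc t) →
  weight (suc (suc (suc t))) F c < F (suc (suc (suc t)))
zeckendorf-bound-step {c} z t bound₂ bound₁ with zero-or-one (at-most-once z (suc (suc t)))
... | inj₁ c₂≡0 = begin-strict
    weight (suc (suc t)) F c + c (suc (suc t)) * F (suc (suc t))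
  ≡⟨ cong (λ x → weight (suc (suc t)) F c + x * F (suc (suc t))) c₂≡0 ⟩
    weight (suc (suc t)) F c + 0
  ≡⟨ +-identityʳ _ ⟩
    weight (suc (suc t)) F c
  <⟨ bound₂ ⟩
    F (suc (suc t))
  ≤⟨ m≤m+n _ _ ⟩
    F (suc (suc (suc t))) ∎
  where open ≤-Reasoning
... | inj₂ c₂≡1 = begin-strict
    weight (suc t) F c + c (suc t) * F (suc t) + c (suc (suc t)) * F (suc (suc t))
  ≡⟨ cong₂ (λ x y → weight (suc t) F c + x * F (suc t) + y * F (suc (suc t))) c₁≡0 c₂≡1 ⟩
    weight (suc t) F c + 0 + 1 * F (suc (suc t))
  ≡⟨ cong₂ _+_ (+-identityʳ (weight (suc t) F c)) (*-identityˡ (F (suc (suc t)))) ⟩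
    weight (suc t) F c + F (suc (suc t))
  <⟨ +-monoˡ-< (F (suc (suc t))) bound₁ ⟩
    F (suc t) + F (suc (suc t))
  ≡⟨ +-comm (F (suc t)) (F (suc (suc t))) ⟩
    F (suc (suc (suc t))) ∎
  where
  open ≤-Reasoning
  c₁≡0 : c (suc t) ≡ 0
  c₁≡0 with zero-or-one (at-most-once z (suc t))
  ... | inj₁ c₁≡0 = c₁≡0
  ... | inj₂ c₁≡1 = ⊥-elim (0≢1+n (trans (sym (non-adjacent z (suc t) c₁≡1)) c₂≡1))

zeckendorf-bound : ∀ {c} → IsZeckendorfState c → ∀ t → weight (suc t) F c < F (suc t)
zeckendorf-bound {c} z zero rewrite *-zeroʳ (c 0) = s≤s z≤n
zeckendorf-bound {c} z (suc zero) rewrite *-zeroʳ (c 0) | *-identityʳ (c 1) = s≤s (at-most-once z 1)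
zeckendorf-bound z (suc (suc t)) =
  zeckendorf-bound-step z t (zeckendorf-bound z (suc t)) (zeckendorf-bound z t)

top-digit-dominates : ∀ {c d} → IsZeckendorfState c → IsZeckendorfState d → ∀ b →
  c b ≡ 1 → d b ≡ 0 → weight (suc b) F d < weight (suc b) F c
top-digit-dominates zc zd zero c₀≡1 _ = ⊥-elim (0≢1+n (trans (sym (no-F0 zc)) c₀≡1))
top-digit-dominates {c} {d} zc zd (suc t) c₁≡1 d₁≡0 = begin-strict
    weight (suc t) F d + d (suc t) * F (suc t)
  ≡⟨ cong (λ x → weight (suc t) F d + x * F (suc t)) d₁≡0 ⟩
    weight (suc t) F d + 0
  ≡⟨ +-identityʳ _ ⟩
    weight (suc t) F d
  <⟨ zeckendorf-bound zd t ⟩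
    F (suc t)
  ≡⟨ sym (*-identityˡ _) ⟩
    1 * F (suc t)
  ≤⟨ m≤n+m (1 * F (suc t)) (weight (suc t) F c) ⟩
    weight (suc t) F c + 1 * F (suc t)
  ≡⟨ cong (λ x → weight (suc t) F c + x * F (suc t)) (sym c₁≡1) ⟩
    weight (suc t) F c + c (suc t) * F (suc t) ∎
  where open ≤-Reasoning

top-digit-agrees : ∀ {c d} → IsZeckendorfState c → IsZeckendorfState d → ∀ b →
  weight (suc b) F c ≡ weight (suc b) F d → c b ≡ d b
top-digit-agrees zc zd b same with zero-or-one (at-most-once zc b) | zero-or-one (at-most-once zd b)
... | inj₁ c≡0 | inj₁ d≡0 = trans c≡0 (sym d≡0)
... | inj₂ c≡1 | inj₂ d≡1 = trans c≡1 (sym d≡1)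
... | inj₂ c≡1 | inj₁ d≡0 = ⊥-elim (<⇒≢ (top-digit-dominates zc zd b c≡1 d≡0) (sym same))
... | inj₁ c≡0 | inj₂ d≡1 = ⊥-elim (<⇒≢ (top-digit-dominates zd zc b d≡1 c≡0) same)

lower-digits-agree : ∀ {c d} → IsZeckendorfState c → IsZeckendorfState d → ∀ b →
  weight (suc b) F c ≡ weight (suc b) F d → weight b F c ≡ weight b F d
lower-digits-agree {c} {d} zc zd b same =
  +-cancelʳ-≡ _ _ _ (trans same (cong (λ x → weight b F d + x * F b) (sym (top-digit-agrees zc zd b same))))

zeckendorf-unique : ∀ {c d} → IsZeckendorfState c → IsZeckendorfState d → ∀ b →
  weight b F c ≡ weight b F d → ∀ j → j < b → c j ≡ d j
zeckendorf-unique zc zd (suc b) same j j<1+b with m≤n⇒m<n∨m≡n (≤-pred j<1+b)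
... | inj₁ j<b  = zeckendorf-unique zc zd b (lower-digits-agree zc zd b same) j j<b
... | inj₂ refl = top-digit-agrees zc zd j same

below-head : ∀ {i is} → NonAdjDecreasing (i ∷ is) → All (λ x → x + 2 ≤ i) is
below-head [ i ]         = []
below-head (j+2≤i ∷ d) =
  j+2≤i ∷ All.map (λ x+2≤j → ≤-trans x+2≤j (≤-trans (m≤m+n _ 2) j+2≤i)) (below-head d)

gap : ∀ {x i} → x + 2 ≤ i → suc x < i
gap {x} {i} x+2≤i = subst (_≤ i) (+-comm x 2) x+2≤i

zeckendorf-cons : ∀ {i rest} → 1 ≤ i → All (λ x → x + 2 ≤ i) rest →
  IsZeckendorfState (count rest) → IsZeckendorfState (count (i ∷ rest))
zeckendorf-cons {i} {rest} 1≤i gaps z = record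
  { no-F0        = cong₂ _+_ (δ-neq (>⇒≢ 1≤i)) (no-F0 z)
  ; at-most-once = once
  ; non-adjacent = apart
  }
  where
  clear-above : ∀ {y} → i ≤ y → count rest y ≡ 0
  clear-above i≤y = count-absent rest (All.map (λ g → <⇒≢ (<-≤-trans (<⇒≤ (gap g)) i≤y)) gaps)

  once : ∀ j → count (i ∷ rest) j ≤ 1
  once j with i ≟ j
  ... | yes refl = ≤-reflexive (cong₂ _+_ (δ-refl i) (clear-above ≤-refl))
  ... | no i≢j rewrite δ-neq i≢j = at-most-once z j

  apart : ∀ j → count (i ∷ rest) j ≡ 1 → count (i ∷ rest) (suc j) ≡ 0
  apart j counted with i ≟ j
  ... | yes refl = cong₂ _+_ (δ-neq (<⇒≢ (n<1+n i))) (clear-above (n≤1+n i))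
  ... | no i≢j = cong₂ _+_ (δ-neq (>⇒≢ (gap j+2≤i))) (non-adjacent z j once-in-rest)
    where
    once-in-rest : count rest j ≡ 1
    once-in-rest = trans (sym (cong (_+ count rest j) (δ-neq i≢j))) counted
    j+2≤i : j + 2 ≤ i
    j+2≤i = count-present rest gaps (≤-reflexive (sym once-in-rest))

zeckendorf-list : ∀ {l} → All (1 ≤_) l → NonAdjDecreasing l → IsZeckendorfState (count l)
zeckendorf-list []          []          = record { no-F0 = refl ; at-most-once = λ _ → z≤n ; non-adjacent = λ _ () }
zeckendorf-list (1≤i ∷ [])  [ i ]       = zeckendorf-cons 1≤i [] (zeckendorf-list [] [])
zeckendorf-list (1≤i ∷ ps)  d@(_ ∷ d′) = zeckendorf-cons 1≤i (below-head d) (zeckendorf-list ps d′)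

entries-≤ : ∀ {s} l → sum (map F l) ≤ s → All (_< suc s) l
entries-≤ []      _     = []
entries-≤ (i ∷ l) sum≤s =
  s≤s (≤-trans (index-≤-F i) (m+n≤o⇒m≤o (F i) sum≤s)) ∷ entries-≤ l (m+n≤o⇒n≤o (F i) sum≤s)

sum-ones : ∀ (l : List ℕ) → sum (map (λ _ → 1) l) ≡ length l
sum-ones []      = refl
sum-ones (_ ∷ l) = cong suc (sum-ones l)

Mergeable : State → ℕ → Set
Mergeable c k = 1 ≤ k × 1 ≤ c k × 1 ≤ c (suc k)

mergeable? : ∀ c → Decidable (Mergeable c)
mergeable? c k = (1 ≤? k) ×-dec (1 ≤? c k) ×-dec (1 ≤? c (suc k))

pair-occupied : ∀ (c : State) a₁ a₂ → (∀ j → count (a₁ ∷ a₂ ∷ []) j ≤ c j) → 1 ≤ c a₁ × 1 ≤ c a₂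
pair-occupied c a₁ a₂ present = first , second
  where
  open ≤-Reasoning
  first : 1 ≤ c a₁
  first = begin
    1                               ≡⟨ sym (δ-refl a₁) ⟩
    δ a₁ a₁                         ≤⟨ m≤m+n _ _ ⟩
    count (a₁ ∷ a₂ ∷ []) a₁         ≤⟨ present a₁ ⟩
    c a₁                            ∎
  second : 1 ≤ c a₂
  second = begin
    1                               ≡⟨ sym (δ-refl a₂) ⟩
    δ a₂ a₂                         ≤⟨ m≤m+n _ 0 ⟩
    δ a₂ a₂ + 0                     ≤⟨ m≤n+m _ (δ a₁ a₂) ⟩
    count (a₁ ∷ a₂ ∷ []) a₂         ≤⟨ present a₂ ⟩
    c a₂                            ∎

pair-present : ∀ (c : State) i → (∀ j → count (i ∷ i ∷ []) j ≤ c j) → 2 ≤ c i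
pair-present c i present =
  subst (_≤ c i) (cong₂ (λ x y → x + (y + 0)) (δ-refl i) (δ-refl i)) (present i)

legal-add : ∀ {c k} → Mergeable c k → Legal (add k) c
legal-add {c} {k} (1≤k , 1≤ck , 1≤csk) = 1≤k , present
  where
  present : ∀ j → count (k ∷ suc k ∷ []) j ≤ c j
  present j with k ≟ j | suc k ≟ j
  ... | yes refl | _
        rewrite δ-refl k | δ-neq (>⇒≢ (n<1+n k)) = 1≤ck
  ... | no k≢sk  | yes refl
        rewrite δ-neq k≢sk | δ-refl (suc k) = 1≤csk
  ... | no k≢j   | no sk≢j
        rewrite δ-neq k≢j | δ-neq sk≢j = z≤n

legal-add⁻ : ∀ {c k} → Legal (add k) c → Mergeable c k
legal-add⁻ {c} (1≤k , present) = 1≤k , pair-occupied c _ _ present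

legal-add11 : ∀ {c} → 2 ≤ c 1 → Legal add11 c
legal-add11 {c} 2≤c₁ = tt , present
  where
  present : ∀ j → count (1 ∷ 1 ∷ []) j ≤ c j
  present zero          = z≤n
  present (suc zero)    = 2≤c₁
  present (suc (suc j)) = z≤n

Greedy : Move → State → Set
Greedy m c = ∀ m′ → Legal m′ c → top m′ ≤ top m

merge : ℕ → ℕ → ℕ → State → State
merge a₁ a₂ q = transfer (a₁ ∷ a₂ ∷ []) (q ∷ [])

record Largest (P : ℕ → Set) (b : ℕ) : Set where
  field
    index   : ℕ
    below   : index < b
    holds   : P index
    maximal : ∀ k → k < b → P k → k ≤ index

largest? : ∀ {P : ℕ → Set} → Decidable P → ∀ b → Largest P b ⊎ (∀ k → k < b → ¬ P k)
largest?         P? zero    = inj₂ (λ _ ())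
largest? {P = P} P? (suc b) with P? b
... | yes Pb = inj₁ (record
        { index = b ; below = n<1+n b ; holds = Pb ; maximal = λ _ k<1+b _ → ≤-pred k<1+b })
... | no ¬Pb = extend (largest? P? b)
  where
  witness-below : ∀ {k} → k < suc b → P k → k < b
  witness-below {k} k<1+b Pk with m≤n⇒m<n∨m≡n (≤-pred k<1+b)
  ... | inj₁ k<b  = k<b
  ... | inj₂ refl = ⊥-elim (¬Pb Pk)

  extend : Largest P b ⊎ (∀ k → k < b → ¬ P k) → Largest P (suc b) ⊎ (∀ k → k < suc b → ¬ P k)
  extend (inj₁ L)    = inj₁ (record
    { index = index ; below = m<n⇒m<1+n below ; holds = holds
    ; maximal = λ k k<1+b Pk → maximal k (witness-below k<1+b Pk) Pk })
    where open Largest L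
  extend (inj₂ none) = inj₂ (λ k k<1+b Pk → none k (witness-below k<1+b Pk) Pk)

unoccupied : ∀ {x} → ¬ (1 ≤ x) → x ≡ 0
unoccupied x≱1 = n≤0⇒n≡0 (≮⇒≥ x≱1)

weight-start : ∀ n b w → 1 ≤ b → weight (suc b) w (start n) ≡ n * w 1
weight-start n (suc zero)    w _ = refl
weight-start n (suc (suc b)) w _ = trans (+-identityʳ _) (weight-start n (suc b) w (s≤s z≤n))

module GreedyPlay (n : ℕ) where

  value size : State → ℕ
  value = weight (suc n) F
  size  = weight (suc n) (λ _ → 1)

  record Invariant (c : State) : Set where
    field
      F0-absent  : c 0 ≡ 0
      upper-once : ∀ j → 2 ≤ j → c j ≤ 1
      supported  : ∀ j → n < j → c j ≡ 0
      value≡n    : value c ≡ n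

  open Invariant

  occupied-≤ : ∀ {c j} → Invariant c → 1 ≤ c j → j < suc n
  occupied-≤ {c} {j} inv 1≤cj with j ≤? n
  ... | yes j≤n = s≤s j≤n
  ... | no  j≰n = ⊥-elim (<⇒≢ 1≤cj (sym (supported inv j (≰⇒> j≰n))))

  mergeable-≤ : ∀ {c k} → Invariant c → Mergeable c k → k < suc n
  mergeable-≤ inv (_ , _ , 1≤csk) = <-trans (n<1+n _) (occupied-≤ inv 1≤csk)

  no-split2 : ∀ {c} → Invariant c → ¬ Legal split2 c
  no-split2 {c} inv (_ , present) = n≮n 1 (≤-trans (pair-present c _ present) (upper-once inv 2 ≤-refl))

  no-split : ∀ {c i} → Invariant c → ¬ Legal (split i) c
  no-split {c} inv (3≤i , present) =
    n≮n 1 (≤-trans (pair-present c _ present) (upper-once inv _ (≤-trans (n≤1+n 2) 3≤i)))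

  -- The indices involved in a merge F a₁ , F a₂ ↦ F q are ≤ n: the consumed
  -- ones are occupied, and F q ≤ value = n bounds q.
  merge-in-range : ∀ {c} a₁ a₂ q → Invariant c → (∀ j → count (a₁ ∷ a₂ ∷ []) j ≤ c j) →
    F a₁ + F a₂ ≡ F q → All (_< suc n) (a₁ ∷ a₂ ∷ []) × q < suc n
  merge-in-range {c} a₁ a₂ q inv present fib = consumed-in-range , s≤s (≤-trans (index-≤-F q) Fq≤n)
    where
    open ≤-Reasoning
    consumed-in-range : All (_< suc n) (a₁ ∷ a₂ ∷ [])
    consumed-in-range = occupied-≤ inv (proj₁ (pair-occupied c a₁ a₂ present))
                      ∷ occupied-≤ inv (proj₂ (pair-occupied c a₁ a₂ present)) ∷ []
    Fq≤n : F q ≤ n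
    Fq≤n = begin
      F q                                   ≡⟨ sym fib ⟩
      F a₁ + F a₂                           ≡⟨ cong (F a₁ +_) (sym (+-identityʳ (F a₂))) ⟩
      sum (map F (a₁ ∷ a₂ ∷ []))            ≡⟨ sym (weight-count (suc n) F consumed-in-range) ⟩
      value (count (a₁ ∷ a₂ ∷ []))          ≤⟨ weight-mono (suc n) F present ⟩
      value c                               ≡⟨ value≡n inv ⟩
      n                                     ∎

  merge-invariant : ∀ {c} a₁ a₂ q → Invariant c → (∀ j → count (a₁ ∷ a₂ ∷ []) j ≤ c j) →
    F a₁ + F a₂ ≡ F q → 2 ≤ q → c q ≡ 0 → Invariant (merge a₁ a₂ q c)
  merge-invariant {c} a₁ a₂ q inv present fib 2≤q cq≡0 = record
    { F0-absent  = n≤0⇒n≡0 (≤-trans (elsewhere (>⇒≢ (≤-trans (s≤s z≤n) 2≤q))) (≤-reflexive (F0-absent inv)))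
    ; upper-once = upper-once′
    ; supported  = λ j n<j →
        n≤0⇒n≡0 (≤-trans (elsewhere (<⇒≢ (≤-<-trans (≤-pred q≤n) n<j))) (≤-reflexive (supported inv j n<j)))
    ; value≡n    = +-cancelʳ-≡ _ _ _ value-balance
    }
    where
    open ≡-Reasoning
    c′ : State
    c′ = merge a₁ a₂ q c
    removed : State
    removed = count (a₁ ∷ a₂ ∷ [])
    ranges = merge-in-range a₁ a₂ q inv present fib
    q≤n = proj₂ ranges

    elsewhere : ∀ {j} → q ≢ j → c′ j ≤ c j
    elsewhere {j} q≢j = ≤-trans (≤-reflexive (trans (cong (λ x → (c j ∸ removed j) + (x + 0)) (δ-neq q≢j))
                                                    (+-identityʳ (c j ∸ removed j))))
                                (m∸n≤m (c j) (removed j))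
    at-q : c′ q ≡ 1
    at-q = cong₂ _+_ (trans (cong (_∸ removed q) cq≡0) (0∸n≡0 (removed q))) (cong (_+ 0) (δ-refl q))

    upper-once′ : ∀ j → 2 ≤ j → c′ j ≤ 1
    upper-once′ j 2≤j with q ≟ j
    ... | yes refl = ≤-reflexive at-q
    ... | no q≢j   = ≤-trans (elsewhere q≢j) (upper-once inv j 2≤j)

    value-balance : value c′ + sum (map F (a₁ ∷ a₂ ∷ [])) ≡ n + sum (map F (a₁ ∷ a₂ ∷ []))
    value-balance = begin
      value c′ + sum (map F (a₁ ∷ a₂ ∷ []))   ≡⟨ weight-transfer (suc n) F present (proj₁ ranges) (q≤n ∷ []) ⟩
      value c + (F q + 0)                      ≡⟨ cong₂ _+_ (value≡n inv) (+-identityʳ (F q)) ⟩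
      n + F q                                  ≡⟨ cong (n +_) (trans (sym fib) (cong (F a₁ +_) (sym (+-identityʳ (F a₂))))) ⟩
      n + sum (map F (a₁ ∷ a₂ ∷ []))           ∎

  merge-size : ∀ {c} a₁ a₂ q → Invariant c → (∀ j → count (a₁ ∷ a₂ ∷ []) j ≤ c j) →
    F a₁ + F a₂ ≡ F q → size c ≡ suc (size (merge a₁ a₂ q c))
  merge-size {c} a₁ a₂ q inv present fib =
    +-cancelʳ-≡ 1 _ _ (trans (sym two-for-one) (+-suc (size (merge a₁ a₂ q c)) 1))
    where
    ranges = merge-in-range a₁ a₂ q inv present fib
    two-for-one : size (merge a₁ a₂ q c) + 2 ≡ size c + 1
    two-for-one = weight-transfer (suc n) (λ _ → 1) present (proj₁ ranges) (proj₂ ranges ∷ [])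

  -- A greedy move from a state satisfying the invariant is a merge whose
  -- target slot is empty (otherwise a merge on a larger summand would be
  -- legal); hence it preserves the invariant and removes one summand.
  greedy-step : ∀ {c m} → Invariant c → Legal m c → Greedy m c →
    Invariant (apply m c) × size c ≡ suc (size (apply m c))
  greedy-step {c} {add k} inv (1≤k , present) greedy =
      merge-invariant k (suc k) (suc (suc k)) inv present fib (s≤s (s≤s z≤n)) target-empty
    , merge-size k (suc k) (suc (suc k)) inv present fib
    where
    fib = F-merge k 1≤k
    target-empty : c (suc (suc k)) ≡ 0
    target-empty = unoccupied λ 1≤c → n≮n (suc k)
      (greedy (add (suc k)) (legal-add (s≤s z≤n , proj₂ (pair-occupied c k (suc k) present) , 1≤c)))
  greedy-step {c} {add11} inv (_ , present) greedy =
      merge-invariant 1 1 2 inv present refl ≤-refl target-empty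
    , merge-size 1 1 2 inv present refl
    where
    target-empty : c 2 ≡ 0
    target-empty = unoccupied λ 1≤c → n≮n 1
      (greedy (add 1) (legal-add (≤-refl , proj₁ (pair-occupied c 1 1 present) , 1≤c)))
  greedy-step {m = split2}  inv legal _ = ⊥-elim (no-split2 inv legal)
  greedy-step {m = split i} inv legal _ = ⊥-elim (no-split inv legal)

  terminal-zeckendorf : ∀ {c} → Invariant c → Terminal c → IsZeckendorfState c
  terminal-zeckendorf {c} inv terminal = record
    { no-F0 = F0-absent inv ; at-most-once = once ; non-adjacent = apart }
    where
    once : ∀ j → c j ≤ 1
    once zero          = ≤-trans (≤-reflexive (F0-absent inv)) z≤n
    once (suc zero)    = ≮⇒≥ (λ 2≤c₁ → terminal add11 (legal-add11 2≤c₁))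
    once (suc (suc j)) = upper-once inv (suc (suc j)) (s≤s (s≤s z≤n))
    apart : ∀ j → c j ≡ 1 → c (suc j) ≡ 0
    apart zero    c₀≡1 = ⊥-elim (0≢1+n (trans (sym (F0-absent inv)) c₀≡1))
    apart (suc j) cj≡1 = unoccupied λ 1≤c →
      terminal (add (suc j)) (legal-add (s≤s z≤n , ≤-reflexive (sym cj≡1) , 1≤c))

  -- By uniqueness, a terminal state has as many summands as the Zeckendorf
  -- decomposition of n.
  terminal-size : ∀ {c zs} → IsZeckendorf n zs → Invariant c → Terminal c → size c ≡ length zs
  terminal-size {c} {zs} (positive , non-adjacent-list , sum≡n) inv terminal = begin
      size c                  ≡⟨ weight-cong (suc n) _ (zeckendorf-unique
                                   (terminal-zeckendorf inv terminal) (zeckendorf-list positive non-adjacent-list)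
                                   (suc n) same-value) ⟩
      size (count zs)         ≡⟨ weight-count (suc n) _ zs-in-range ⟩
      sum (map (λ _ → 1) zs)  ≡⟨ sum-ones zs ⟩
      length zs               ∎
    where
    open ≡-Reasoning
    zs-in-range = entries-≤ zs (≤-reflexive sum≡n)
    same-value : value c ≡ value (count zs)
    same-value = trans (value≡n inv) (sym (trans (weight-count (suc n) F zs-in-range) sum≡n))

  play-length : ∀ {c k zs} → IsZeckendorf n zs → Invariant c → Plays c k → k + length zs ≡ size c
  play-length hz inv (done terminal) = sym (terminal-size hz inv terminal)
  play-length hz inv (step m legal greedy play) with greedy-step inv legal greedy
  ... | inv′ , shrinks = trans (cong suc (play-length hz inv′ play)) (sym shrinks)

  -- Under the invariant a greedy move is available unless the state is terminal:
  -- take add k for the largest mergeable k, else add11 if F 1 repeats.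
  greedy-move-or-terminal : ∀ {c} → Invariant c → (Σ Move λ m → Legal m c × Greedy m c) ⊎ Terminal c
  greedy-move-or-terminal {c} inv with largest? (mergeable? c) (suc n)
  ... | inj₁ L = inj₁ (add index , legal-add holds , greedy)
    where
    open Largest L
    greedy : Greedy (add index) c
    greedy (add k)   legal = s≤s (maximal k (mergeable-≤ inv (legal-add⁻ legal)) (legal-add⁻ legal))
    greedy add11     _     = s≤s z≤n
    greedy split2    legal = ⊥-elim (no-split2 inv legal)
    greedy (split i) legal = ⊥-elim (no-split inv legal)
  ... | inj₂ none with 2 ≤? c 1
  ...   | yes 2≤c₁ = inj₁ (add11 , legal-add11 2≤c₁ , greedy)
    where
    greedy : Greedy add11 c
    greedy (add k)   legal = ⊥-elim (none k (mergeable-≤ inv (legal-add⁻ legal)) (legal-add⁻ legal))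
    greedy add11     _     = ≤-refl
    greedy split2    legal = ⊥-elim (no-split2 inv legal)
    greedy (split i) legal = ⊥-elim (no-split inv legal)
  ...   | no 2≰c₁ = inj₂ terminal
    where
    terminal : Terminal c
    terminal (add k)   legal       = none k (mergeable-≤ inv (legal-add⁻ legal)) (legal-add⁻ legal)
    terminal add11     (_ , present) = 2≰c₁ (pair-present c _ present)
    terminal split2    legal       = no-split2 inv legal
    terminal (split i) legal       = no-split inv legal

  -- A greedy play exists from every state with fewer than s summands, by
  -- recursion on s: every greedy move lowers the number of summands.
  greedy-play-within : ∀ s {c} → Invariant c → size c < s → Σ ℕ (Plays c)
  greedy-play-within (suc s) inv size<s with greedy-move-or-terminal inv
  ... | inj₂ terminal = 0 , done terminal
  ... | inj₁ (m , legal , greedy) with greedy-step inv legal greedy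
  ...   | inv′ , shrinks with greedy-play-within s inv′ (subst (_≤ s) shrinks (≤-pred size<s))
  ...     | k , play = suc k , step m legal greedy play

  greedy-play : ∀ {c} → Invariant c → Σ ℕ (Plays c)
  greedy-play {c} inv = greedy-play-within (suc (size c)) inv (n<1+n (size c))

  start-invariant : 1 ≤ n → Invariant (start n)
  start-invariant 1≤n = record
    { F0-absent  = refl
    ; upper-once = λ { (suc zero) (s≤s ()) ; (suc (suc j)) _ → z≤n }
    ; supported  = λ { (suc zero) n<1 → ⊥-elim (≤⇒≯ 1≤n n<1) ; (suc (suc j)) _ → refl }
    ; value≡n    = trans (weight-start n n F 1≤n) (*-identityʳ n)
    }

  start-size : 1 ≤ n → size (start n) ≡ n
  start-size 1≤n = trans (weight-start n n (λ _ → 1) 1≤n) (*-identityʳ n)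

lemma2p5 : (n : ℕ) → 1 ≤ n → (zs : List ℕ) → IsZeckendorf n zs →
           (k : ℕ) → (Plays (start n) k ⇔ k ≡ n ∸ length zs)
lemma2p5 n 1≤n zs hz k = mk⇔ length-of (λ k≡ → subst (Plays (start n)) (trans (length-of play) (sym k≡)) play)
  where
  open GreedyPlay n
  open ≡-Reasoning
  length-of : ∀ {k} → Plays (start n) k → k ≡ n ∸ length zs
  length-of {k} p = begin
    k                              ≡⟨ sym (m+n∸n≡m k (length zs)) ⟩
    k + length zs ∸ length zs      ≡⟨ cong (_∸ length zs) (play-length hz (start-invariant 1≤n) p) ⟩
    size (start n) ∸ length zs     ≡⟨ cong (_∸ length zs) (start-size 1≤n) ⟩
    n ∸ length zs                  ∎
  play : Plays (start n) (proj₁ (greedy-play (start-invariant 1≤n)))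
  play = proj₂ (greedy-play (start-invariant 1≤n))
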